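{- Let $a,b\in\mathbf{V}$ with $a\subseteq b$. Then there is a realizer $t\in\mathcal{R}$ with $t\Vdash \mathfrak{r}(a)\subseteq\mathfrak{r}(b)$.
   Context: Setting (Krivine realizability) over a model $\mathbf{V}$ of ZF with realizability algebra $(\Lambda,\Pi,\succ,\perp\!\!\!\perp)$: $\Lambda$ closed $\lambda_c$-terms (variables, application, abstraction, $\mathsf{cc}$, continuation constants $\mathsf{k}_\pi$, possibly special instructions), $\Pi$ stacks (stack bottoms and $t\cdot\pi$), realizers $\mathcal{R}$ = terms without continuation constants, $\succ$ a preorder on processes $t\star\pi$ containing push $ts\star\pi\succ t\star s\cdot\pi$, grab $\lambda u.t\star s\cdot\pi\succ t[u:=s]\star\pi$, save $\mathsf{cc}\star t\cdot\pi\succ t\star\mathsf{k}_\pi\cdot\pi$, restore $\mathsf{k}_\sigma\star t\cdot\pi\succ t\star\sigma$, and a pole $\perp\!\!\!\perp$ closed under anti-reduction. Names $\mathbf{N}=\bigcup_\alpha\mathbf{N}_\alpha$, $\mathbf{N}_\alpha=\bigcup_{\beta<\alpha}\mathcal{P}(\mathbf{N}_\beta\times\Pi)$. Falsity values: $\|a\notin b\|=\{t\cdot t'\cdot\pi:\exists c\,((c,\pi)\in b, t\Vdash a\subseteq c, t'\Vdash c\subseteq a)\}$, $\|a\subseteq b\|=\{t\cdot\pi:\exists c\,((c,\pi)\in a,t\Vdash c\notin b)\}$ (defined simultaneously by induction on ranks), where $t\Vdash\varphi$ iff $t\star\pi\in\perp\!\!\!\perp$ for every $\pi\in\|\varphi\|$.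 The reish (recursive name) of $x\in\mathbf{V}$ is defined recursively by $\mathfrak{r}(x)=\{(\mathfrak{r}(y),\pi):y\in x,\ \pi\in\Pi\}$. -}

module Defs where

open import Data.Nat using (ℕ; zero; suc)
open import Data.Fin using (Fin; zero; suc)
open import Data.Product using (Σ; Σ-syntax; _×_; _,_)
open import Relation.Binary.PropositionalEquality using (_≡_)

mutual
  data Term (Inst Bot : Set) : ℕ → Set where
    var  : ∀ {n} → Fin n → Term Inst Bot n
    app  : ∀ {n} → Term Inst Bot n → Term Inst Bot n → Term Inst Bot n
    lam  : ∀ {n} → Term Inst Bot (suc n) → Term Inst Bot n
    cc   : ∀ {n} → Term Inst Bot n
    kont : ∀ {n} → Stack Inst Bot → Term Inst Bot n
    inst : ∀ {n} → Inst → Term Inst Bot n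

  data Stack (Inst Bot : Set) : Set where
    bot : Bot → Stack Inst Bot
    _·_ : Term Inst Bot 0 → Stack Inst Bot → Stack Inst Bot

infixr 5 _·_

Λ : Set → Set → Set
Λ Inst Bot = Term Inst Bot 0

Proc : Set → Set → Set
Proc Inst Bot = Λ Inst Bot × Stack Inst Bot

module _ {Inst Bot : Set} where
  private T = Term Inst Bot

  ext : ∀ {n m} → (Fin n → Fin m) → Fin (suc n) → Fin (suc m)
  ext ρ zero    = zero
  ext ρ (suc i) = suc (ρ i)

  ren : ∀ {n m} → (Fin n → Fin m) → T n → T m
  ren ρ (var i)   = var (ρ i)
  ren ρ (app t s) = app (ren ρ t) (ren ρ s)
  ren ρ (lam t)   = lam (ren (ext ρ) t)
  ren ρ cc        = cc
  ren ρ (kont π)  = kont π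
  ren ρ (inst c)  = inst c

  exts : ∀ {n m} → (Fin n → T m) → Fin (suc n) → T (suc m)
  exts σ zero    = var zero
  exts σ (suc i) = ren suc (σ i)

  sub : ∀ {n m} → (Fin n → T m) → T n → T m
  sub σ (var i)   = σ i
  sub σ (app t s) = app (sub σ t) (sub σ s)
  sub σ (lam t)   = lam (sub (exts σ) t)
  sub σ cc        = cc
  sub σ (kont π)  = kont π
  sub σ (inst c)  = inst c

  _[_] : T 1 → T 0 → T 0
  t [ s ] = sub (λ { zero → s }) t

  data NoKont : ∀ {n} → T n → Set where
    var  : ∀ {n} (i : Fin n) → NoKont (var i)
    app  : ∀ {n} {t s : T n} → NoKont t → NoKont s → NoKont (app t s)
    lam  : ∀ {n} {t : T (suc n)} → NoKont t → NoKont (lam t)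
    cc   : ∀ {n} → NoKont {n} cc
    inst : ∀ {n} (c : Inst) → NoKont {n} (inst c)

  IsRealizer : Λ Inst Bot → Set
  IsRealizer = NoKont

record RealizabilityAlgebra : Set₁ where
  field
    Inst Bot : Set
    _≻_      : Proc Inst Bot → Proc Inst Bot → Set
    ≻-refl   : ∀ p → p ≻ p
    ≻-trans  : ∀ {p q r} → p ≻ q → q ≻ r → p ≻ r
    push     : ∀ (t s : Λ Inst Bot) π → (app t s , π) ≻ (t , s · π)
    grab     : ∀ (t : Term Inst Bot 1) (s : Λ Inst Bot) π → (lam t , s · π) ≻ (t [ s ] , π)
    save     : ∀ (t : Λ Inst Bot) π → (cc , t · π) ≻ (t , kont π · π)
    restore  : ∀ σ (t : Λ Inst Bot) π → (kont σ , t · π) ≻ (t , σ)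
    Pole     : Proc Inst Bot → Set
    anti     : ∀ {p q} → p ≻ q → Pole q → Pole p

-- Ground model V: Aczel's iterative sets (well-founded trees)

data 𝕍 : Set₁ where
  sup : (I : Set) → (I → 𝕍) → 𝕍

mutual
  _≐_ : 𝕍 → 𝕍 → Set
  sup I f ≐ sup J g = ((i : I) → Σ[ j ∈ J ] (f i ≐ g j)) × ((j : J) → Σ[ i ∈ I ] (f i ≐ g j))

_∈𝕍_ : 𝕍 → 𝕍 → Set
x ∈𝕍 sup J g = Σ[ j ∈ J ] (x ≐ g j)

_⊆𝕍_ : 𝕍 → 𝕍 → Set
sup I f ⊆𝕍 b = (i : I) → f i ∈𝕍 b

module Realizability (A : RealizabilityAlgebra) where
  open RealizabilityAlgebra A

  -- a name is (hereditarily) a set of pairs (c , π) with c a name, π a stack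
  data Name : Set₁ where
    sup : (I : Set) → (I → Name) → (I → Stack Inst Bot) → Name

  mutual
    ‖_⊆_‖ : Name → Name → Stack Inst Bot → Set
    ‖ sup I f p ⊆ b ‖ ρ =
      Σ[ t ∈ Λ Inst Bot ] Σ[ π ∈ Stack Inst Bot ] Σ[ i ∈ I ]
        (ρ ≡ t · π) × (p i ≡ π) × (t ⊩∉ f i , b)

    ‖_∉_‖ : Name → Name → Stack Inst Bot → Set
    ‖ a ∉ sup J g p ‖ ρ =
      Σ[ t ∈ Λ Inst Bot ] Σ[ t' ∈ Λ Inst Bot ] Σ[ π ∈ Stack Inst Bot ] Σ[ j ∈ J ]
        (ρ ≡ t · t' · π) × (p j ≡ π) × (t ⊩⊆ a , g j) × (t' ⊩⊆ g j , a)

    _⊩⊆_,_ : Λ Inst Bot → Name → Name → Set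
    t ⊩⊆ a , b = ∀ ρ → ‖ a ⊆ b ‖ ρ → Pole (t , ρ)

    _⊩∉_,_ : Λ Inst Bot → Name → Name → Set
    t ⊩∉ a , b = ∀ ρ → ‖ a ∉ b ‖ ρ → Pole (t , ρ)

  reish : 𝕍 → Name
  reish (sup I f) = sup (I × Stack Inst Bot) (λ { (i , π) → reish (f i) }) (λ { (i , π) → π })

{-# OPTIONS --safe #-}
module Submission where

-- The realizer is ι = Θ (λx.λs. s x x), with Θ Turing's fixed-point combinator, so
-- that ι ⋆ s · π ≻ s ⋆ ι · ι · π. A counter-stack for 𝔯(a) ⊆ 𝔯(b) is s · π with
-- s ⊩ 𝔯(y) ∉ 𝔯(b) for some y ∈ a; choosing z ∈ b with y = z, the stack ι · ι · π
-- lies in ‖𝔯(y) ∉ 𝔯(b)‖ as soon as ι realizes both 𝔯(y) ⊆ 𝔯(z) and 𝔯(z) ⊆ 𝔯(y),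
-- because 𝔯(b) pairs 𝔯(z) with every stack, in particular with π. That ι realizes
-- both inclusions between 𝔯(y) and 𝔯(z) whenever y = z follows by ∈-induction.

open import Defs
open import Data.Product using (Σ-syntax; _×_; _,_; map₂; swap)
open import Data.Fin using (zero; suc)
open import Relation.Binary.PropositionalEquality using (refl)

module Combinators (A : RealizabilityAlgebra) where
  open RealizabilityAlgebra A

  Θ-half : Λ Inst Bot
  Θ-half = lam (lam (app (var zero) (app (app (var (suc zero)) (var (suc zero))) (var zero))))

  Θ : Λ Inst Bot
  Θ = app Θ-half Θ-half

  Θ-realizer : IsRealizer Θ
  Θ-realizer = app half half
    where
    half : IsRealizer Θ-half
    half = lam (lam (app (var zero) (app (app (var (suc zero)) (var (suc zero))) (var zero))))

  Θ-unfold : ∀ f π → (app Θ f , π) ≻ (f , app Θ f · π)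
  Θ-unfold f π =
    ≻-trans (push Θ f π)
    (≻-trans (push Θ-half Θ-half (f · π))
    (≻-trans (grab _ Θ-half (f · π))
    (≻-trans (grab _ f π)
    (push f (app Θ f) π))))

  duplicate : Λ Inst Bot
  duplicate = lam (lam (app (app (var zero) (var (suc zero))) (var (suc zero))))

  ι : Λ Inst Bot
  ι = app Θ duplicate

  ι-realizer : IsRealizer ι
  ι-realizer = app Θ-realizer duplicate-realizer
    where
    duplicate-realizer : IsRealizer duplicate
    duplicate-realizer = lam (lam (app (app (var zero) (var (suc zero))) (var (suc zero))))

  -- Stated for ι itself: substituting into a renamed closed term only computes
  -- away for a concrete term, so duplicate ⋆ u · s · π ≻ s ⋆ u · u · π is not
  -- definitional for a variable u.
  ι-step : ∀ s π → (ι , s · π) ≻ (s , ι · ι · π)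
  ι-step s π =
    ≻-trans (Θ-unfold duplicate (s · π))
    (≻-trans (grab _ ι (s · π))
    (≻-trans (grab _ s π)
    (≻-trans (push (app s ι) ι π)
    (push s ι (ι · π)))))

module ReishInclusion (A : RealizabilityAlgebra) where
  open RealizabilityAlgebra A
  open Realizability A
  open Combinators A

  _⊩⊆⊇_,_ : Λ Inst Bot → Name → Name → Set
  t ⊩⊆⊇ a , b = (t ⊩⊆ a , b) × (t ⊩⊆ b , a)

  ι-⊩⊆-reish : ∀ {I J} (f : I → 𝕍) (g : J → 𝕍) →
    ((i : I) → Σ[ j ∈ J ] (ι ⊩⊆⊇ reish (f i) , reish (g j))) →
    ι ⊩⊆ reish (sup I f) , reish (sup J g)
  ι-⊩⊆-reish f g match .(s · π) (s , π , (i , .π) , refl , refl , s⊩∉)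
    with match i
  ... | j , (ι⊩⊆ , ι⊩⊇) =
    anti (ι-step s π) (s⊩∉ (ι · ι · π) (ι , ι , π , (j , π) , refl , refl , ι⊩⊆ , ι⊩⊇))

  ι-⊩⊆⊇-reish : (x y : 𝕍) → x ≐ y → ι ⊩⊆⊇ reish x , reish y
  ι-⊩⊆⊇-reish (sup I f) (sup J g) (forth , back) =
      ι-⊩⊆-reish f g (λ i → map₂ (λ {j} → ι-⊩⊆⊇-reish (f i) (g j)) (forth i))
    , ι-⊩⊆-reish g f (λ j → map₂ (λ {i} e → swap (ι-⊩⊆⊇-reish (f i) (g j) e)) (back j))

  ι-⊩⊆-reish-⊆ : (a b : 𝕍) → a ⊆𝕍 b → ι ⊩⊆ reish a , reish b
  ι-⊩⊆-reish-⊆ (sup I f) (sup J g) a⊆b =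
    ι-⊩⊆-reish f g (λ i → map₂ (λ {j} → ι-⊩⊆⊇-reish (f i) (g j)) (a⊆b i))

proposition13p2 : (A : RealizabilityAlgebra) → (a b : 𝕍) → a ⊆𝕍 b →
    Σ[ t ∈ Λ (RealizabilityAlgebra.Inst A) (RealizabilityAlgebra.Bot A) ]
    (IsRealizer t × Realizability._⊩⊆_,_ A t (Realizability.reish A a) (Realizability.reish A b))
proposition13p2 A a b a⊆b =
  Combinators.ι A , Combinators.ι-realizer A , ReishInclusion.ι-⊩⊆-reish-⊆ A a b a⊆b
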